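{- If $T$ is a $\beta(1,0)$-tree with $h(T)=T$ and root label equal to $1$, then $T$ is either the one-node tree or the one-edge tree.
   Context: A $\beta(1,0)$-tree is a rooted plane tree (the children of each node are linearly ordered from left to right) whose nodes are labeled with positive integers such that: leaves have label $1$; the root has label equal to the sum of its children's labels; every other node has label between $1$ and the sum of its children's labels. For a $\beta(1,0)$-tree $T$, $\mathrm{root}(T)$ is the label of the root, the rightmost path is the path from the root obtained by repeatedly passing to the rightmost child until reaching a leaf, and $\mathrm{rpath}(T)$ is its number of edges. The depth of a node is its distance from the root. The map $h$ on $\beta(1,0)$-trees is defined recursively (it is a well-defined map with $\mathrm{rpath}(h(A))=\mathrm{root}(A)$ for every $A$ with at least two nodes): (i) $h$ maps the one-node tree and the one-edge tree to themselves. (ii) If the root of $T$ has exactly one child $v$, $v$ has label $c$, and $v$ is not a leaf: let $A$ be the subtree rooted at $v$, with the label of $v$ replaced by the sum of the labels of its children. Then $h(T)$ is obtained from $h(A)$ by attaching a new leaf (label $1$) as the new rightmost child of the node at depth $c-1$ on the rightmost path of $h(A)$, and increasing by $1$ the labels of all nodes on the rightmost path above the new leaf (i.e. at depths $0,1,\dots,c-1$). (iii) If the root of $T$ has at least two children: let $A$ be the tree formed by the root and all its subtrees except the rightmost one, with root label equal to the sum of the labels of those children, and let $B$ be the tree formed by the root and its rightmost subtree, with root label equal to the label of the rightmost child. Then $h(T)$ is obtained by identifying the rightmost leaf of $h(B)$ with the root of $h(A)$, the identified node keeping label $1$. -}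

module Defs where

open import Data.Nat using (ℕ; zero; suc; _+_; _∸_; _≤_)
open import Data.List using (List; []; _∷_; _++_)
open import Data.Product using (_×_; _,_)
open import Data.Unit using (⊤)
open import Relation.Binary.PropositionalEquality using (_≡_)

-- Rooted plane trees with ℕ labels: a node carries its label and the
-- left-to-right ordered list of its children.
data Tree : Set where
  node : ℕ → List Tree → Tree

label : Tree → ℕ
label (node l _) = l

sumLabels : List Tree → ℕ
sumLabels []       = 0
sumLabels (t ∷ ts) = label t + sumLabels ts

size : Tree → ℕ
sizes : List Tree → ℕ
size (node _ cs) = suc (sizes cs)
sizes []       = 0
sizes (t ∷ ts) = size t + sizes ts

NonRootOK  : Tree → Set
AllNonRoot : List Tree → Set
NonRootOK (node l [])       = l ≡ 1
NonRootOK (node l (c ∷ cs)) = 1 ≤ l × l ≤ sumLabels (c ∷ cs) × AllNonRoot (c ∷ cs)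
AllNonRoot []       = ⊤
AllNonRoot (t ∷ ts) = NonRootOK t × AllNonRoot ts

IsBeta : Tree → Set
IsBeta (node l [])       = l ≡ 1
IsBeta (node l (c ∷ cs)) = l ≡ sumLabels (c ∷ cs) × AllNonRoot (c ∷ cs)

oneNode : Tree
oneNode = node 1 []

oneEdge : Tree
oneEdge = node 1 (node 1 [] ∷ [])

-- graft d T : attach a new leaf (label 1) as the new rightmost child of
-- the node at depth d on the rightmost path of T, and increase by 1 the
-- labels of the nodes at depths 0..d on the rightmost path.
graft     : ℕ → Tree → Tree
graftLast : ℕ → List Tree → List Tree
graft zero    (node l cs) = node (suc l) (cs ++ (node 1 [] ∷ []))
graft (suc d) (node l cs) = node (suc l) (graftLast d cs)
graftLast d []           = []
graftLast d (t ∷ [])     = graft d t ∷ []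
graftLast d (t ∷ u ∷ us) = t ∷ graftLast d (u ∷ us)

-- glue B A : identify the rightmost leaf of B with the root of A; the
-- identified node has label 1.
glue     : Tree → Tree → Tree
glueLast : List Tree → Tree → List Tree
glue (node l [])       (node _ as) = node 1 as
glue (node l (c ∷ cs)) a           = node l (glueLast (c ∷ cs) a)
glueLast []           a = []
glueLast (t ∷ [])     a = glue t a ∷ []
glueLast (t ∷ u ∷ us) a = t ∷ glueLast (u ∷ us) a

unsnoc : Tree → List Tree → List Tree × Tree
unsnoc t []       = [] , t
unsnoc t (u ∷ us) with unsnoc u us
... | (i , l) = (t ∷ i) , l

-- h with a fuel parameter (the recursion of the paper decreases the
-- number of nodes; fuel = size T suffices).
hf : ℕ → Tree → Tree
hf zero    t = t
hf (suc n) (node r []) = oneNode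
hf (suc n) (node r (node c [] ∷ [])) = oneEdge
hf (suc n) (node r (node c (d ∷ ds) ∷ [])) =
  graft (c ∸ 1) (hf n (node (sumLabels (d ∷ ds)) (d ∷ ds)))
hf (suc n) (node r (t₁ ∷ t₂ ∷ ts)) with unsnoc t₂ ts
... | (i , last) =
  glue (hf n (node (label last) (last ∷ [])))
       (hf n (node (sumLabels (t₁ ∷ i)) (t₁ ∷ i)))

h : Tree → Tree
h t = hf (size t) t

module Submission where

-- Split on the shape of the root of T.
--  * No child, or a single leaf child: leaves have label 1, so T is
--    oneNode or oneEdge.
--  * Two or more children: every non-root node of a β(1,0)-tree has a
--    positive label, so the root label, being the sum of the children's
--    labels, is at least the number of children (≥ 2), not 1.
--  * A single internal child v: the root label equals the label c of v,
--    so c = 1, and rule (ii) gives h T = graft 0 (h A).  Grafting at the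
--    root always makes a leaf the rightmost child of the root, whereas the
--    only child v of T is not a leaf; hence h T ≠ T.

open import Defs
open import Data.Sum using (_⊎_; inj₁; inj₂)
open import Data.Nat using (ℕ; _+_; _≤_; s≤s; z≤n)
open import Data.Nat.Properties using (+-mono-≤; +-identityʳ; ≤-trans; <⇒≢)
open import Data.List using (List; []; _∷_; length)
open import Data.List.Properties using (∷ʳ-injective)
open import Data.Product using (_,_; proj₂)
open import Relation.Binary.PropositionalEquality using (_≡_; _≢_; refl; cong; trans; sym)

nonRoot-positive : (t : Tree) → NonRootOK t → 1 ≤ label t
nonRoot-positive (node l [])       refl       = s≤s z≤n
nonRoot-positive (node l (c ∷ cs)) (1≤l , _) = 1≤l

length≤sumLabels : (ts : List Tree) → AllNonRoot ts → length ts ≤ sumLabels ts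
length≤sumLabels []       _        = z≤n
length≤sumLabels (t ∷ ts) (ok , oks) =
  +-mono-≤ (nonRoot-positive t ok) (length≤sumLabels ts oks)

children : Tree → List Tree
children (node _ us) = us

-- Grafting at depth 0 appends a leaf as the rightmost child of the root,
-- so the result never has a single internal node as the root's only child.
graft₀≢singleInternalChild : (t : Tree) (l c : ℕ) (d : Tree) (ds : List Tree) →
                             graft 0 t ≢ node l (node c (d ∷ ds) ∷ [])
graft₀≢singleInternalChild (node _ cs) l c d ds eq
  with proj₂ (∷ʳ-injective cs [] (cong children eq))
... | ()

lemma1 : (T : Tree) → IsBeta T → h T ≡ T → label T ≡ 1 → T ≡ oneNode ⊎ T ≡ oneEdge
-- The one-node tree.
lemma1 (node r []) refl _ _ = inj₁ refl
-- One leaf child: its label is 1 (it is a leaf) and r = 1 by hypothesis.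
lemma1 (node r (node c [] ∷ [])) (_ , (refl , _)) _ refl = inj₂ refl
-- One internal child of label c: the root label is c, so c = 1 and
-- h T = graft 0 (h A), which cannot have a single internal root child.
lemma1 (node r (node c (d ∷ ds) ∷ [])) (r≡c+0 , _) hT≡T refl
  with trans (sym (+-identityʳ c)) (sym r≡c+0)
... | refl with graft₀≢singleInternalChild _ 1 1 d ds hT≡T
...   | ()
-- At least two children: the root label is at least 2.
lemma1 (node r (t₁ ∷ t₂ ∷ ts)) (r≡sum , oks) _ refl
  with <⇒≢ (≤-trans (s≤s (s≤s z≤n)) (length≤sumLabels (t₁ ∷ t₂ ∷ ts) oks)) r≡sum
... | ()
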